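{- Let $E$ be a finite set, $k\in\mathbb{N}$, $K=\{0,\dots,k\}$, $w:E\to\mathbb{Z}$, and $\mathit{sub}_w:K^E\to K^E$, $\mathit{sub}_w(a)(e)=a(e)\ominus_{\mathbb{Z}}w(e)$ with $x\ominus_{\mathbb{Z}}y=\min\{\max\{x-y,0\},k\}$. Then for every $a\in K^E$, the $a$-approximation $(\mathit{sub}_w)^a_\#:\mathcal{P}([E]^a)\to\mathcal{P}([E]^{\mathit{sub}_w(a)})$ is given by $$(\mathit{sub}_w)^a_\#(E')=\{e\in E'\mid 0<a(e)-w(e)\le k\}\qquad\text{for }E'\subseteq[E]^a.$$
   Context: $K=\{0,\dots,k\}$ is the MV-chain with $n\oplus m=\min\{n+m,k\}$, complement $\overline{n}=k-n$, natural order the usual order, and $n\ominus m=\max\{n-m,0\}$, extended pointwise to $K^E$. For $a\in K^E$, $[E]^a=\{e\in E\mid a(e)\neq0\}$; for $E'\subseteq E$ and $\delta\in K$, $\delta_{E'}$ is the function equal to $\delta$ on $E'$ and $0$ elsewhere. For a non-expansive $g:K^E\to K^Z$ and $0<\delta\in K$, $g^{a,\delta}_\#:\mathcal{P}([E]^a)\to\mathcal{P}([Z]^{g(a)})$ is $g^{a,\delta}_\#(E')=\{z\in[Z]^{g(a)}\mid g(a)(z)\ominus g(a\ominus\delta_{E'})(z)\ge\delta\}$; it is known that these functions coincide for all $\delta$ with $0<\delta\le\iota$ for some $\iota>0$, and the $a$-approximation $g^a_\#$ is this common function. -}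

module Defs where

open import Data.Nat using (ℕ; zero; suc; _∸_; _≤_; _⊓_)
open import Data.Integer as ℤ using (ℤ; +_; _-_; _⊔_; ∣_∣)
open import Data.Fin using (Fin)
open import Data.Fin.Subset using (Subset; _∈_)
open import Data.Fin.Subset.Properties using (_∈?_)
open import Data.Product using (_×_)
open import Relation.Binary.PropositionalEquality using (_≢_)
open import Relation.Nullary using (does)
open import Data.Bool using (if_then_else_)

-- Elements of K^E (E = Fin n, K = {0,…,k}) are represented as functions
-- Fin n → ℕ together with the hypothesis  InK k a : ∀ e → a e ≤ k.
InK : ∀ {n} → ℕ → (Fin n → ℕ) → Set
InK k a = ∀ e → a e ≤ k

_⊖ᶠ_ : ∀ {n} → (Fin n → ℕ) → (Fin n → ℕ) → (Fin n → ℕ)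
(a ⊖ᶠ b) e = a e ∸ b e

δ[_]_ : ∀ {n} → Subset n → ℕ → (Fin n → ℕ)
(δ[ E' ] δ) e = if does (e ∈? E') then δ else 0

InSupp : ∀ {n} → (Fin n → ℕ) → Fin n → Set
InSupp a e = a e ≢ 0

SubSupp : ∀ {n} → Subset n → (Fin n → ℕ) → Set
SubSupp E' a = ∀ e → e ∈ E' → InSupp a e

-- membership in g^{a,δ}_#(E') :
--   z ∈ [Z]^{g(a)}  and  g(a)(z) ⊖ g(a ⊖ δ_{E'})(z) ≥ δ
approxδ : ∀ {n m} → ((Fin n → ℕ) → (Fin m → ℕ)) →
          (Fin n → ℕ) → ℕ → Subset n → Fin m → Set
approxδ g a δ E' z = InSupp (g a) z × δ ≤ g a z ∸ g (a ⊖ᶠ (δ[ E' ] δ)) z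

subℤ : ℕ → ℕ → ℤ → ℕ
subℤ k x y = k ⊓ ∣ (+ x - y) ⊔ + 0 ∣

sub : ∀ {n} → ℕ → (Fin n → ℤ) → (Fin n → ℕ) → (Fin n → ℕ)
sub k w a e = subℤ k (a e) (w e)

{-# OPTIONS --safe #-}
-- Since K is discrete, ι = 1 and only δ = 1 matters. Coordinatewise sub_w is
-- x ↦ clamp (x − w e) with clamp = min k ∘ max 0, and subtracting 1_{E'} lowers
-- its argument by one exactly on E'. A clamp drops by one under x ↦ x − 1
-- precisely when 0 < x ≤ k and is constant otherwise.
module Submission where

open import Defs
open import Data.Nat using (ℕ; _≤_; _<_)
open import Data.Integer as ℤ using (ℤ; +_; _-_)
open import Data.Fin using (Fin)
open import Data.Fin.Subset using (Subset; _∈_)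
open import Data.Product using (Σ; _×_)
open import Function.Bundles using (_⇔_)

open import Data.Nat as ℕ using (zero; suc; _∸_; _⊓_; z≤n; s≤s)
open import Data.Nat.Properties
  using (≤-trans; ≤-refl; n≤1+n; ≰⇒>; m∸n≤m; n>0⇒n≢0; n∸n≡0; m+n∸n≡m;
         m≤n⇒m⊓n≡m; m≥n⇒m⊓n≡n; ⊓-zeroʳ; ⊔-identityʳ)
open import Data.Integer.Properties using (drop‿+≤+)
open import Data.Integer.Tactic.RingSolver using (solve-∀)
open import Data.Fin.Subset.Properties using (_∈?_)
open import Data.Product using (_,_)
open import Function.Bundles using (mk⇔; module Equivalence)
open import Relation.Binary.PropositionalEquality
  using (_≡_; _≢_; refl; sym; trans; subst)
open import Relation.Nullary using (¬_; yes; no; contradiction)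

open Equivalence

-- subℤ k m w unfolds to clamp k (+ m - w).
clamp : ℕ → ℤ → ℕ
clamp k x = k ⊓ ℤ.∣ x ℤ.⊔ + 0 ∣

1≤m∸n⇒m≢0 : ∀ {m} n → 1 ≤ m ∸ n → m ≢ 0
1≤m∸n⇒m≢0 {m} n p = n>0⇒n≢0 (≤-trans p (m∸n≤m m n))

1≰n∸n : ∀ n → ¬ (1 ≤ n ∸ n)
1≰n∸n n p = contradiction (subst (1 ≤_) (n∸n≡0 n) p) λ ()

⊓-suc-jump⇔< : ∀ k j → (1 ≤ k ⊓ suc j ∸ k ⊓ j) ⇔ (suc j ≤ k)
⊓-suc-jump⇔< k j = mk⇔ jump⇒< <⇒jump
  where
  jump⇒< : 1 ≤ k ⊓ suc j ∸ k ⊓ j → suc j ≤ k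
  jump⇒< p with suc j ℕ.≤? k
  ... | yes j<k = j<k
  ... | no j≮k =
    contradiction (subst (λ t → 1 ≤ t ∸ k ⊓ j) k⊓suc-j≡k⊓j p) (1≰n∸n (k ⊓ j))
    where
    k≤j : k ≤ j
    k≤j = ℕ.s≤s⁻¹ (≰⇒> j≮k)
    k⊓suc-j≡k⊓j : k ⊓ suc j ≡ k ⊓ j
    k⊓suc-j≡k⊓j = trans (m≤n⇒m⊓n≡m (≤-trans k≤j (n≤1+n j))) (sym (m≤n⇒m⊓n≡m k≤j))

  <⇒jump : suc j ≤ k → 1 ≤ k ⊓ suc j ∸ k ⊓ j
  <⇒jump j<k
    rewrite m≥n⇒m⊓n≡n j<k | m≥n⇒m⊓n≡n (≤-trans (n≤1+n j) j<k) | m+n∸n≡m 1 j = ≤-refl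

clamp-jump⇔ : ∀ k x → (1 ≤ clamp k x ∸ clamp k (x - + 1)) ⇔ (+ 0 ℤ.< x × x ℤ.≤ + k)
clamp-jump⇔ k x@(+ zero) =
  mk⇔ (λ p → contradiction (⊓-zeroʳ k) (1≤m∸n⇒m≢0 (clamp k (x - + 1)) p))
      (λ { (ℤ.+<+ () , _) })
clamp-jump⇔ k (+ suc j) rewrite ⊔-identityʳ j =
  mk⇔ (λ p → ℤ.+<+ (s≤s z≤n) , ℤ.+≤+ (to (⊓-suc-jump⇔< k j) p))
      (λ (_ , j<k) → from (⊓-suc-jump⇔< k j) (drop‿+≤+ j<k))
clamp-jump⇔ k x@(ℤ.-[1+ _ ]) =
  mk⇔ (λ p → contradiction (⊓-zeroʳ k) (1≤m∸n⇒m≢0 (clamp k (x - + 1)) p))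
      (λ { (() , _) })

[1+m-w]-1≡m-w : ∀ m w → ((+ 1 ℤ.+ m) - w) - + 1 ≡ m - w
[1+m-w]-1≡m-w = solve-∀

subℤ-jump⇔ : ∀ k m w →
  (1 ≤ subℤ k (suc m) w ∸ subℤ k m w) ⇔ (+ 0 ℤ.< + suc m - w × + suc m - w ℤ.≤ + k)
subℤ-jump⇔ k m w = subst P ([1+m-w]-1≡m-w (+ m) w) (clamp-jump⇔ k x)
  where
  x = + suc m - w
  P : ℤ → Set
  P y = (1 ≤ clamp k x ∸ clamp k y) ⇔ (+ 0 ℤ.< x × x ℤ.≤ + k)

approx₁-sub⇔ : ∀ {n} k (w : Fin n → ℤ) a (E' : Subset n) → SubSupp E' a → ∀ e →
  approxδ (sub k w) a 1 E' e ⇔ (e ∈ E' × (+ 0 ℤ.< + a e - w e) × (+ a e - w e ℤ.≤ + k))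
approx₁-sub⇔ k w a E' E'⊆supp e with e ∈? E'
... | no e∉E' = mk⇔ (λ (_ , p) → contradiction p (1≰n∸n (sub k w a e)))
                    (λ (e∈E' , _) → contradiction e∈E' e∉E')
... | yes e∈E' with a e | E'⊆supp e e∈E'
...   | zero  | a≢0 = contradiction refl a≢0
...   | suc m | _   = mk⇔ (λ (_ , p) → e∈E' , to (subℤ-jump⇔ k m (w e)) p)
                          (λ (_ , r) → supported (subℤ k m (w e)) (from (subℤ-jump⇔ k m (w e)) r))
  where
  supported : ∀ {x} y → 1 ≤ x ∸ y → x ≢ 0 × 1 ≤ x ∸ y
  supported y p = 1≤m∸n⇒m≢0 y p , p

mainTheorem14 : (n k : ℕ) (w : Fin n → ℤ) (a : Fin n → ℕ) → InK k a →
  Σ ℕ λ ι → 0 < ι ×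
    ((δ : ℕ) → 0 < δ → δ ≤ ι → δ ≤ k →
      (E' : Subset n) → SubSupp E' a →
      (e : Fin n) →
        approxδ (sub k w) a δ E' e
          ⇔ (e ∈ E' × (ℤ.+ 0 ℤ.< + a e - w e) × (+ a e - w e ℤ.≤ + k)))
mainTheorem14 n k w a _ = 1 , s≤s z≤n , approx
  where
  approx : ∀ δ → 0 < δ → δ ≤ 1 → δ ≤ k → (E' : Subset n) → SubSupp E' a → ∀ e →
    approxδ (sub k w) a δ E' e ⇔ (e ∈ E' × (+ 0 ℤ.< + a e - w e) × (+ a e - w e ℤ.≤ + k))
  approx 1             _ _        _ = approx₁-sub⇔ k w a
  approx (suc (suc _)) _ (s≤s ()) _
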